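{- Let $\Theta=\{\langle\langle A_1\rangle\rangle\bigcirc\varphi_1,\dots,\langle\langle A_m\rangle\rangle\bigcirc\varphi_m,[[A']]\bigcirc\psi\}$ be a set of $\mathrm{ATL}^{+}$ formulae such that $A_i\cap A_j=\emptyset$ for all $1\le i,j\le m$ with $i\neq j$, and $A_i\subseteq A'$ for all $1\le i\le m$. Let $\mathcal{M}$ be a concurrent game model and $s$ a state with $\mathcal{M},s\models\Theta$. For each $1\le i\le m$ let $\sigma_{A_i}$ be an $A_i$-action at $s$ witnessing the truth of $\langle\langle A_i\rangle\rangle\bigcirc\varphi_i$ at $s$, and let $\sigma^c_{A'}$ be an $A'$-co-action at $s$ witnessing the truth of $[[A']]\bigcirc\psi$ at $s$. Then there exists $s'\in\mathsf{Out}(s,\sigma_{A_1})\cap\dots\cap\mathsf{Out}(s,\sigma_{A_m})\cap\mathsf{Out}(s,\sigma^c_{A'})$ such that $\mathcal{M},s'\models\{\varphi_1,\dots,\varphi_m,\psi\}$.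
   Context: A concurrent game model over a finite set of agents $\mathbb{A}$ has, at each state $s$, a non-empty set of available actions for each agent, and a deterministic successor $\mathsf{out}(s,\sigma)$ for each action profile $\sigma$ (one available action per agent). For $A\subseteq\mathbb{A}$, an $A$-action at $s$ is a tuple $\sigma_A$ of available actions of the agents in $A$; an action profile extends it if it agrees with it on $A$. An $A$-co-action at $s$ is a map $\sigma^c_A$ assigning to every $A$-action at $s$ an action tuple for $\mathbb{A}\setminus A$ available at $s$. $\mathsf{Out}(s,\sigma_A)$ is the set of $\mathsf{out}(s,\sigma)$ over action profiles $\sigma$ extending $\sigma_A$; $\mathsf{Out}(s,\sigma^c_A)$ is the set of $\mathsf{out}(s,\sigma)$ where $\sigma$ combines some $A$-action $\sigma_A$ with $\sigma^c_A(\sigma_A)$. An $A$-action $\sigma_A$ witnesses $\langle\langle A\rangle\rangle\bigcirc\varphi$ at $s$ if $\varphi$ holds at every state of $\mathsf{Out}(s,\sigma_A)$; an $A$-co-action $\sigma^c_A$ witnesses $[[A]]\bigcirc\psi$ at $s$ if $\psi$ holds at every state of $\mathsf{Out}(s,\sigma^c_A)$. -}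

module Defs where

open import Data.Nat using (ℕ)
open import Data.Fin using (Fin)
open import Data.Fin.Subset using (Subset; _∈_; _∉_)
open import Data.Product using (Σ; Σ-syntax; ∃; ∃-syntax; _×_; _,_)
open import Data.Empty using (⊥)
open import Relation.Binary.PropositionalEquality using (_≡_)

record CGM (n : ℕ) : Set₁ where
  field
    State    : Set
    Act      : State → Fin n → Set
    nonEmpty : (s : State) (a : Fin n) → Act s a
    out      : (s : State) → ((a : Fin n) → Act s a) → State

module _ {n : ℕ} (M : CGM n) where
  open CGM M

  Profile : State → Set
  Profile s = (a : Fin n) → Act s a

  CoalAction : State → Subset n → Set
  CoalAction s A = (a : Fin n) → a ∈ A → Act s a

  ComplAction : State → Subset n → Set
  ComplAction s A = (a : Fin n) → a ∉ A → Act s a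

  CoAction : State → Subset n → Set
  CoAction s A = CoalAction s A → ComplAction s A

  Extends : {s : State} {A : Subset n} → Profile s → CoalAction s A → Set
  Extends {A = A} σ σA = (a : Fin n) (p : a ∈ A) → σ a ≡ σA a p

  ExtendsC : {s : State} {A : Subset n} → Profile s → ComplAction s A → Set
  ExtendsC {A = A} σ τ = (a : Fin n) (p : a ∉ A) → σ a ≡ τ a p

  InOut : {s : State} {A : Subset n} → CoalAction s A → State → Set
  InOut {s} σA s' = Σ[ σ ∈ Profile s ] (Extends σ σA × out s σ ≡ s')

  InOutCo : {s : State} {A : Subset n} → CoAction s A → State → Set
  InOutCo {s} {A} σc s' =
    Σ[ σA ∈ CoalAction s A ] Σ[ σ ∈ Profile s ]
      (Extends σ σA × ExtendsC σ (σc σA) × out s σ ≡ s')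

  WitnessesDia : {s : State} {A : Subset n} → CoalAction s A → (State → Set) → Set
  WitnessesDia σA φ = ∀ s' → InOut σA s' → φ s'

  WitnessesBox : {s : State} {A : Subset n} → CoAction s A → (State → Set) → Set
  WitnessesBox σc ψ = ∀ s' → InOutCo σc s' → ψ s'

  SatDia : State → Subset n → (State → Set) → Set
  SatDia s A φ = Σ[ σA ∈ CoalAction s A ] WitnessesDia σA φ

  SatBox : State → Subset n → (State → Set) → Set
  SatBox s A ψ = Σ[ σc ∈ CoAction s A ] WitnessesBox σc ψ

Disjoint : {n : ℕ} → Subset n → Subset n → Set
Disjoint {n} A B = (a : Fin n) → a ∈ A → a ∈ B → ⊥

module Submission where

-- The witnessing actions σ i of the pairwise disjoint coalitions
-- A i never disagree, so they glue into one action profile; its restriction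
-- σA' is an A'-action refining every σ i (each A i ⊆ A').  Feeding σA' to the
-- co-action σc and completing it with the answer σc σA' gives a profile whose
-- outcome s' lies in Out(s, σA') ∩ Out(s, σc).  Since σA' refines σ i,
-- Out(s, σA') ⊆ Out(s, σ i), so s' lies in every required outcome set, and
-- the witnessing properties of σ i and σc give φ i s' and ψ s'.

open import Defs
open import Data.Nat using (ℕ)
open import Data.Fin using (Fin)
open import Data.Fin.Properties using (any?) renaming (_≟_ to _≟ᶠ_)
open import Data.Fin.Subset using (Subset; _⊆_; _∈_)
open import Data.Fin.Subset.Properties using (_∈?_)
open import Data.Vec.Properties.WithK using ([]=-irrelevant)
open import Data.Product using (Σ; Σ-syntax; _×_; _,_; proj₁; proj₂)
open import Data.Empty using (⊥-elim)
open import Relation.Nullary using (yes; no)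
open import Relation.Binary.PropositionalEquality
  using (_≡_; _≢_; refl; trans; cong)

module _ {n : ℕ} (M : CGM n) where
  open CGM M

  restrict : {s : State} {A : Subset n} → Profile M s → CoalAction M s A
  restrict σ a _ = σ a

  combine : {s : State} {A : Subset n} →
            CoalAction M s A → ComplAction M s A → Profile M s
  combine {A = A} σA τ a with a ∈? A
  ... | yes a∈A = σA a a∈A
  ... | no  a∉A = τ a a∉A

  -- combine σA τ extends σA (membership proofs in a subset are unique) ...
  combine-extends : {s : State} {A : Subset n}
                    (σA : CoalAction M s A) (τ : ComplAction M s A) →
                    Extends M (combine σA τ) σA
  combine-extends {A = A} σA τ a a∈A with a ∈? A
  ... | yes a∈A′ = cong (σA a) ([]=-irrelevant a∈A′ a∈A)
  ... | no  a∉A  = ⊥-elim (a∉A a∈A)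

  -- ... and agrees with τ outside A (proofs of a ∉ A are definitionally equal).
  combine-extendsᶜ : {s : State} {A : Subset n}
                     (σA : CoalAction M s A) (τ : ComplAction M s A) →
                     ExtendsC M (combine σA τ) τ
  combine-extendsᶜ {A = A} σA τ a a∉A with a ∈? A
  ... | yes a∈A = ⊥-elim (a∉A a∈A)
  ... | no  _   = refl

  respond : {s : State} {A : Subset n}
            (σc : CoAction M s A) (σA : CoalAction M s A) →
            let s′ = out s (combine σA (σc σA)) in
            InOut M σA s′ × InOutCo M σc s′
  respond σc σA =
      (profile , combine-extends σA (σc σA) , refl)
    , (σA , profile , combine-extends σA (σc σA)
          , combine-extendsᶜ σA (σc σA) , refl)
    where
    profile : Profile M _
    profile = combine σA (σc σA)

  inOut-refine : {s : State} {A B : Subset n}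
                 {σA : CoalAction M s A} (τ : Profile M s) →
                 A ⊆ B → Extends M τ σA →
                 {s′ : State} → InOut M {A = B} (restrict τ) s′ → InOut M σA s′
  inOut-refine τ A⊆B τ⊒σA (σ , σ⊒τ , reach) =
    σ , (λ a a∈A → trans (σ⊒τ a (A⊆B a∈A)) (τ⊒σA a a∈A)) , reach

  module Glue {m : ℕ} {s : State} {A : Fin m → Subset n}
              (σ : (i : Fin m) → CoalAction M s (A i)) where

    glue : Profile M s
    glue a with any? (λ i → a ∈? A i)
    ... | yes (i , a∈Aᵢ) = σ i a a∈Aᵢ
    ... | no  _          = nonEmpty s a

    glue-extends : ((i j : Fin m) → i ≢ j → Disjoint (A i) (A j)) →
                   (i : Fin m) → Extends M glue (σ i)
    glue-extends disjoint i a a∈Aᵢ with any? (λ j → a ∈? A j)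
    ... | no  none = ⊥-elim (none (i , a∈Aᵢ))
    ... | yes (j , a∈Aⱼ) with j ≟ᶠ i
    ...   | yes refl = cong (σ i a) ([]=-irrelevant a∈Aⱼ a∈Aᵢ)
    ...   | no  j≢i  = ⊥-elim (disjoint j i j≢i a a∈Aⱼ a∈Aᵢ)

lemma4 : {n : ℕ} (M : CGM n) (m : ℕ) (A : Fin m → Subset n) (A' : Subset n)
         (φ : Fin m → CGM.State M → Set) (ψ : CGM.State M → Set) →
         ((i j : Fin m) → i ≢ j → Disjoint (A i) (A j)) →
         ((i : Fin m) → A i ⊆ A') →
         (s : CGM.State M) →
         ((i : Fin m) → SatDia M s (A i) (φ i)) →
         SatBox M s A' ψ →
         (σ : (i : Fin m) → CoalAction M s (A i)) →
         ((i : Fin m) → WitnessesDia M (σ i) (φ i)) →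
         (σc : CoAction M s A') →
         WitnessesBox M σc ψ →
         Σ[ s' ∈ CGM.State M ]
           (((i : Fin m) → InOut M (σ i) s') × InOutCo M σc s' ×
            ((i : Fin m) → φ i s') × ψ s')
lemma4 M m A A' φ ψ disjoint A⊆A' s _ _ σ σ-wit σc σc-wit =
  s′ , in-σ , in-σc , (λ i → σ-wit i s′ (in-σ i)) , σc-wit s′ in-σc
  where
  open Glue M σ
  σA′ : CoalAction M s A'
  σA′ = restrict M glue

  s′ : CGM.State M
  s′ = CGM.out M s (combine M σA′ (σc σA′))

  in-σA′ : InOut M σA′ s′
  in-σA′ = proj₁ (respond M σc σA′)

  in-σc : InOutCo M σc s′
  in-σc = proj₂ (respond M σc σA′)

  in-σ : (i : Fin m) → InOut M (σ i) s′
  in-σ i = inOut-refine M glue (A⊆A' i) (glue-extends disjoint i) in-σA′
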